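{- Let $P$ be a finite binomial poset of rank $n$ with factorial function $B(k) = 2^{k-1}$ for $1 \leq k \leq n$. Then $P$ is isomorphic to the butterfly poset $T_n$.
   Context: A finite binomial poset is a poset with a unique minimal element $\hat 0$ and a unique maximal element, in which every interval is graded (rank function $\rho$; $[x,y]$ is a $k$-interval if $\rho(y)-\rho(x)=k$), and for every $k$ any two $k$-intervals have the same number $B(k)$ of maximal chains. The butterfly poset $T_n$ is the graded poset of rank $n$ with a minimum, a maximum, and exactly two elements of each rank $1,\ldots,n-1$, in which every element of rank $k$ is below every element of rank $k+1$. -}

module Defs where

open import Data.Nat using (ℕ; zero; suc; _∸_; _^_) renaming (_<_ to _<ℕ_)
open import Data.Fin using (Fin; toℕ)
open import Data.Fin.Properties using (any?)
open import Data.Bool using (Bool)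
open import Data.List using (List; []; _∷_)
open import Data.Product using (Σ; ∃; _×_; _,_)
open import Data.Sum using (_⊎_)
open import Function.Bundles using (_↔_; Inverse)
open import Relation.Nullary using (¬_; Dec)
open import Relation.Nullary.Decidable using (True; _×-dec_; ¬?)
open import Relation.Binary.PropositionalEquality using (_≡_; _≢_)
open import Relation.Binary.Structures using (IsDecPartialOrder)
open import Level using (0ℓ)

record FinitePoset : Set₁ where
  field
    size              : ℕ
    _≤_               : Fin size → Fin size → Set
    isDecPartialOrder : IsDecPartialOrder _≡_ _≤_

  open IsDecPartialOrder isDecPartialOrder public
    using () renaming (_≤?_ to _≤?_; _≟_ to _≟_)

  Elem : Set
  Elem = Fin size

  _<_ : Elem → Elem → Set
  x < y = x ≤ y × x ≢ y

  _<?_ : ∀ x y → Dec (x < y)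
  x <? y = (x ≤? y) ×-dec ¬? (x ≟ y)

  _⋖_ : Elem → Elem → Set
  x ⋖ y = x < y × ¬ (∃ λ w → x < w × w < y)

  _⋖?_ : ∀ x y → Dec (x ⋖ y)
  x ⋖? y = (x <? y) ×-dec ¬? (any? λ w → (x <? w) ×-dec (w <? y))

  -- A maximal chain of the interval [x , y] (finite poset), written as
  -- the list z₁ ∷ … ∷ zₖ of its elements after x:  x ⋖ z₁ ⋖ … ⋖ zₖ = y.
  IsMaxChain : Elem → Elem → List Elem → Set
  IsMaxChain x y []      = x ≡ y
  IsMaxChain x y (z ∷ l) = x ⋖ z × IsMaxChain z y l

  isMaxChain? : ∀ x y l → Dec (IsMaxChain x y l)
  isMaxChain? x y []      = x ≟ y
  isMaxChain? x y (z ∷ l) = (x ⋖? z) ×-dec isMaxChain? z y l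

  MaxChains : Elem → Elem → Set
  MaxChains x y = Σ (List Elem) λ l → True (isMaxChain? x y l)

-- P is a finite binomial poset of rank n with factorial function B.
-- (B 0 = 1 is automatic: the only maximal chain of [x , x] is [].)

record IsBinomialPoset (P : FinitePoset) (n : ℕ) (B : ℕ → ℕ) : Set where
  open FinitePoset P
  field
    ⊥̂       : Elem
    ⊤̂       : Elem
    ⊥̂-least : ∀ x → ⊥̂ ≤ x
    ⊤̂-great : ∀ x → x ≤ ⊤̂
    ρ       : Elem → ℕ
    ρ-⊥̂     : ρ ⊥̂ ≡ 0
    ρ-cover : ∀ {x y} → x ⋖ y → ρ y ≡ suc (ρ x)
    ρ-⊤̂     : ρ ⊤̂ ≡ n
    binomial : ∀ x y → x ≤ y → MaxChains x y ↔ Fin (B (ρ y ∸ ρ x))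

butterflyFactorial : ℕ → ℕ
butterflyFactorial k = 2 ^ (k ∸ 1)

data Butterfly : ℕ → Set where
  bot : ∀ {n} → Butterfly n
  -- mid i b has rank 1 + i, for i < n, so ranks 1 … n in T (suc n)
  mid : ∀ {n} → Fin n → Bool → Butterfly (suc n)
  top : ∀ {n} → Butterfly (suc n)

rankT : ∀ {n} → Butterfly n → ℕ
rankT bot         = 0
rankT (mid i b)   = suc (toℕ i)
rankT (top {n})   = suc n

_≤T_ : ∀ {n} → Butterfly n → Butterfly n → Set
x ≤T y = x ≡ y ⊎ rankT x <ℕ rankT y

record _≅T_ (P : FinitePoset) (n : ℕ) : Set where
  open FinitePoset P
  field
    iso      : Elem ↔ Butterfly n
  open Inverse iso public using (to; from)
  field
    to-order : ∀ x y → (x ≤ y → to x ≤T to y) × (to x ≤T to y → x ≤ y)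

module Submission where

-- Maximal chains of [0̂, 1̂] through distinct elements of the same rank r are distinct, so rank r has at
-- most B(n) / (B(r) B(n − r)) = 2^(n−1) / 2^(n−2) = 2 elements when 0 < r < n; and a 2-interval has
-- B(2) = 2 maximal chains, hence two distinct middle elements. So each such rank has exactly two elements,
-- and both lie below every element of rank r + 1, being the two middles of a 2-interval ending there.
-- Chaining these comparabilities, x ≤ y exactly when x = y or ρ x < ρ y, which is the order of T n.

open import Defs
open import Data.Nat
  using (ℕ; zero; suc; _+_; _*_; _∸_; _^_; z≤n; s≤s; NonZero)
  renaming (_≤_ to _≤ℕ_; _<_ to _<ℕ_; _<?_ to _<ℕ?_)
open import Data.Nat.Properties
  using ( +-suc; +-cancelʳ-≡; m+n∸n≡m; m+n∸m≡n; m≤n+m; n≤1+n; ≤-pred; <⇒≢; ≤⇒≯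
        ; m≤n⇒m<n∨m≡n; m≤n⇒∃[o]m+o≡n; ^-distribˡ-+-*; m^n>0; m^n≢0; m*n≢0
        ; *-cancelʳ-≤; suc-injective; +-comm; <⇒≤; ≮⇒≥; n≤0⇒n≡0 )
  renaming (≤-refl to ≤ℕ-refl; ≤-trans to ≤ℕ-trans; ≤-antisym to ≤ℕ-antisym)
open import Data.Fin using (Fin; zero; suc; toℕ; fromℕ<)
open import Data.Fin.Properties using (toℕ-injective; toℕ<n; toℕ-fromℕ<; fromℕ<-injective; *↔×; injective⇒≤)
open import Data.Bool using (Bool; true; false)
open import Data.Bool.Properties using (T-irrelevant)
open import Data.List using (List; []; _∷_; _++_; length)
open import Data.List.Properties using (∷-injectiveˡ; ∷-injectiveʳ; ++-cancelˡ)
open import Data.Product using (Σ; ∃; ∃₂; _×_; _,_; proj₁; proj₂)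
open import Data.Product.Function.NonDependent.Propositional using (_×-↔_)
open import Data.Product.Function.Dependent.Propositional using (Σ-↔)
open import Data.Sum using (_⊎_; inj₁; inj₂)
open import Function using (_∘_)
open import Function.Bundles using (_↔_; _⇔_; Inverse; Injection; Equivalence; mk↔ₛ′; mk↣; mk⇔)
open import Function.Definitions using (Injective)
open import Function.Construct.Composition using (_↣-∘_)
open import Function.Properties.Inverse using (↔-refl; ↔-sym; ↔-trans; ↔⇒↣)
open import Relation.Nullary using (yes; no; contradiction)
open import Relation.Nullary.Decidable using (toWitness; fromWitness)
open import Relation.Binary.PropositionalEquality
open import Relation.Binary.Structures using (IsDecPartialOrder)

++-injectiveˡ : ∀ {A : Set} (xs xs′ : List A) {ys ys′ : List A} →
                length xs ≡ length xs′ → xs ++ ys ≡ xs′ ++ ys′ → xs ≡ xs′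
++-injectiveˡ []       []         _   _  = refl
++-injectiveˡ (x ∷ xs) (x′ ∷ xs′) len eq =
  cong₂ _∷_ (∷-injectiveˡ eq) (++-injectiveˡ xs xs′ (suc-injective len) (∷-injectiveʳ eq))

module MaxChainProperties (P : FinitePoset) where
  open FinitePoset P
  open IsDecPartialOrder isDecPartialOrder using () renaming (reflexive to ≤-reflexive; trans to ≤-trans)

  maxChain-++ : ∀ {x y z} l l′ → IsMaxChain x z l → IsMaxChain z y l′ → IsMaxChain x y (l ++ l′)
  maxChain-++ []      l′ refl        c′ = c′
  maxChain-++ (w ∷ l) l′ (x⋖w , c) c′ = x⋖w , maxChain-++ l l′ c c′

  maxChain-target-unique : ∀ {x y y′} l → IsMaxChain x y l → IsMaxChain x y′ l → y ≡ y′
  maxChain-target-unique []      x≡y       x≡y′       = trans (sym x≡y) x≡y′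
  maxChain-target-unique (w ∷ l) (_ , c) (_ , c′) = maxChain-target-unique l c c′

  maxChain⇒≤ : ∀ {x y} l → IsMaxChain x y l → x ≤ y
  maxChain⇒≤ []      x≡y                     = ≤-reflexive x≡y
  maxChain⇒≤ (w ∷ l) (((x≤w , _) , _) , c) = ≤-trans x≤w (maxChain⇒≤ l c)

  MaxChains-≡ : ∀ {x y} {c c′ : MaxChains x y} → proj₁ c ≡ proj₁ c′ → c ≡ c′
  MaxChains-≡ {c = l , t} {.l , t′} refl = cong (l ,_) (T-irrelevant t t′)

  _⁀_ : ∀ {x y z} → MaxChains x z → MaxChains z y → MaxChains x y
  (l , t) ⁀ (l′ , t′) = l ++ l′ , fromWitness (maxChain-++ l l′ (toWitness t) (toWitness t′))

module BinomialPoset {P : FinitePoset} {n : ℕ} {B : ℕ → ℕ}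
                     (IB : IsBinomialPoset P n B) (B-positive : ∀ k → 0 <ℕ B k) where
  open FinitePoset P
  open IsBinomialPoset IB
  open MaxChainProperties P
  open IsDecPartialOrder isDecPartialOrder using () renaming (reflexive to ≤-reflexive; trans to ≤-trans)

  ρ-maxChain : ∀ {x y} l → IsMaxChain x y l → ρ y ≡ length l + ρ x
  ρ-maxChain         []      x≡y       = cong ρ (sym x≡y)
  ρ-maxChain {x} {y} (w ∷ l) (x⋖w , c) = begin
    ρ y                    ≡⟨ ρ-maxChain l c ⟩
    length l + ρ w         ≡⟨ cong (length l +_) (ρ-cover x⋖w) ⟩
    length l + suc (ρ x)   ≡⟨ +-suc (length l) (ρ x) ⟩
    suc (length l + ρ x)   ∎
    where open ≡-Reasoning

  maxChain : ∀ {x y} → x ≤ y → Σ (List Elem) (IsMaxChain x y)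
  maxChain {x} {y} x≤y with Inverse.from (binomial x y x≤y) (fromℕ< (B-positive _))
  ... | l , t = l , toWitness t

  ρ-strictMono : ∀ {x y} → x ≤ y → x ≢ y → ρ x <ℕ ρ y
  ρ-strictMono {x} {y} x≤y x≢y with maxChain x≤y
  ... | []    , x≡y = contradiction x≡y x≢y
  ... | w ∷ l , c   = subst (ρ x <ℕ_) (sym (ρ-maxChain (w ∷ l) c)) (s≤s (m≤n+m (ρ x) (length l)))

  ≤∧ρ≡⇒≡ : ∀ {x y} → x ≤ y → ρ x ≡ ρ y → x ≡ y
  ≤∧ρ≡⇒≡ {x} {y} x≤y ρx≡ρy with x ≟ y
  ... | yes x≡y = x≡y
  ... | no  x≢y = contradiction ρx≡ρy (<⇒≢ (ρ-strictMono x≤y x≢y))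

  ρ-mono : ∀ {x y} → x ≤ y → ρ x ≤ℕ ρ y
  ρ-mono {x} {y} x≤y with x ≟ y
  ... | yes refl = ≤ℕ-refl
  ... | no  x≢y = <⇒≤ (ρ-strictMono x≤y x≢y)

  ρ≤n : ∀ x → ρ x ≤ℕ n
  ρ≤n x = subst (ρ x ≤ℕ_) ρ-⊤̂ (ρ-mono (⊤̂-great x))

  maxChain-∃-ofRank : ∀ {x y j} l → IsMaxChain x y l → ρ x ≤ℕ j → j ≤ℕ ρ y → ∃ λ u → x ≤ u × u ≤ y × ρ u ≡ j
  maxChain-∃-ofRank {x} l c ρx≤j j≤ρy with m≤n⇒m<n∨m≡n ρx≤j
  ... | inj₂ ρx≡j = x , ≤-reflexive refl , maxChain⇒≤ l c , ρx≡j
  maxChain-∃-ofRank []      refl      _ j≤ρy | inj₁ ρx<j = contradiction ρx<j (≤⇒≯ j≤ρy)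
  maxChain-∃-ofRank (w ∷ l) (x⋖w , c) _ j≤ρy | inj₁ ρx<j
    with u , w≤u , u≤y , ρu≡j ← maxChain-∃-ofRank l c (subst (_≤ℕ _) (sym (ρ-cover x⋖w)) ρx<j) j≤ρy
    = u , ≤-trans (proj₁ (proj₁ x⋖w)) w≤u , u≤y , ρu≡j

  ∃-below : ∀ {y j} → j ≤ℕ ρ y → ∃ λ u → u ≤ y × ρ u ≡ j
  ∃-below {y} {j} j≤ρy
    with l , c ← maxChain (⊥̂-least y)
    with u , _ , u≤y , ρu≡j ← maxChain-∃-ofRank l c (subst (_≤ℕ j) (sym ρ-⊥̂) z≤n) j≤ρy
    = u , u≤y , ρu≡j

  maxChains↔ : ∀ {x y k} → x ≤ y → ρ y ∸ ρ x ≡ k → MaxChains x y ↔ Fin (B k)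
  maxChains↔ {x} {y} x≤y gap = subst (λ d → MaxChains x y ↔ Fin (B d)) gap (binomial x y x≤y)

  middle-of-2-chain : ∀ {x y} l → IsMaxChain x y l → ρ y ≡ 2 + ρ x →
                      ∃ λ a → l ≡ a ∷ y ∷ [] × a ≤ y × ρ a ≡ suc (ρ x)
  middle-of-2-chain {x} l c ρy with +-cancelʳ-≡ (ρ x) (length l) 2 (trans (sym (ρ-maxChain l c)) ρy)
  middle-of-2-chain (a ∷ b ∷ []) (x⋖a , a⋖b , b≡y) ρy | refl =
    a , cong (λ w → a ∷ w ∷ []) b≡y , maxChain⇒≤ (b ∷ []) (a⋖b , b≡y) , ρ-cover x⋖a

  two-middles : 1 <ℕ B 2 → ∀ {x y} → x ≤ y → ρ y ≡ 2 + ρ x →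
                ∃₂ λ a b → a ≢ b × a ≤ y × b ≤ y × ρ a ≡ suc (ρ x) × ρ b ≡ suc (ρ x)
  two-middles 1<B₂ {x} {y} x≤y ρy
    with middle chain₀ | middle chain₁ | chain₀≢chain₁
    where
      chains↔ : MaxChains x y ↔ Fin (B 2)
      chains↔ = maxChains↔ x≤y (trans (cong (_∸ ρ x) ρy) (m+n∸n≡m 2 (ρ x)))
      chain : Fin (B 2) → MaxChains x y
      chain = Inverse.from chains↔
      chain₀ chain₁ : MaxChains x y
      chain₀ = chain (fromℕ< (B-positive 2))
      chain₁ = chain (fromℕ< 1<B₂)
      chain₀≢chain₁ : chain₀ ≢ chain₁
      chain₀≢chain₁ = (λ ()) ∘ fromℕ<-injective 0 1 (B-positive 2) 1<B₂ ∘ Injection.injective (↔⇒↣ (↔-sym chains↔))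
      middle : (c : MaxChains x y) → ∃ λ a → proj₁ c ≡ a ∷ y ∷ [] × a ≤ y × ρ a ≡ suc (ρ x)
      middle (l , t) = middle-of-2-chain l (toWitness t) ρy
  ... | a , l₀≡ , a≤y , ρa | b , l₁≡ , b≤y , ρb | c₀≢c₁ =
    a , b , (λ a≡b → c₀≢c₁ (MaxChains-≡ (trans l₀≡ (trans (cong (λ w → w ∷ y ∷ []) a≡b) (sym l₁≡))))) ,
    a≤y , b≤y , ρa , ρb

  sameRank-maxChains-bound : ∀ {k r x y} (z : Fin k → Elem) → Injective _≡_ _≡_ z → (∀ i → ρ (z i) ≡ r) →
    x ≤ y → (∀ i → x ≤ z i) → (∀ i → z i ≤ y) → k * (B (r ∸ ρ x) * B (ρ y ∸ r)) ≤ℕ B (ρ y ∸ ρ x)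
  sameRank-maxChains-bound {k} {r} {x} {y} z z-injective ρz x≤y x≤z z≤y =
    injective⇒≤ (Injection.injective (↔⇒↣ (binomial x y x≤y) ↣-∘ (mk↣ glue-injective ↣-∘ ↔⇒↣ (↔-sym through↔))))
    where
      Through : Set
      Through = Σ (Fin k) λ i → MaxChains x (z i) × MaxChains (z i) y

      through↔ : Through ↔ Fin (k * (B (r ∸ ρ x) * B (ρ y ∸ r)))
      through↔ = ↔-trans
        (Σ-↔ {B = λ _ → Fin (B (r ∸ ρ x)) × Fin (B (ρ y ∸ r))} ↔-refl
          (maxChains↔ (x≤z _) (cong (_∸ ρ x) (ρz _)) ×-↔ maxChains↔ (z≤y _) (cong (ρ y ∸_) (ρz _))))
        (↔-sym (↔-trans *↔× (↔-refl ×-↔ *↔×)))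

      glue : Through → MaxChains x y
      glue (i , c , c′) = c ⁀ c′

      glue-injective : Injective _≡_ _≡_ glue
      glue-injective {i , (l₁ , t₁) , (l₂ , t₂)} {i′ , (l₁′ , t₁′) , (l₂′ , t₂′)} glued
        with ++-injectiveˡ l₁ l₁′ (+-cancelʳ-≡ (ρ x) _ _ (begin
               length l₁ + ρ x   ≡⟨ sym (ρ-maxChain l₁ (toWitness t₁)) ⟩
               ρ (z i)           ≡⟨ trans (ρz i) (sym (ρz i′)) ⟩
               ρ (z i′)          ≡⟨ ρ-maxChain l₁′ (toWitness t₁′) ⟩
               length l₁′ + ρ x  ∎)) (cong proj₁ glued)
        where open ≡-Reasoning
      ... | refl with z-injective (maxChain-target-unique l₁ (toWitness t₁) (toWitness t₁′))
      ... | refl = cong (i ,_) (cong₂ _,_ (MaxChains-≡ refl) (MaxChains-≡ (++-cancelˡ l₁ l₂ l₂′ (cong proj₁ glued))))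

butterflyFactorial-split : ∀ {r n} → 0 <ℕ r → r <ℕ n →
                           2 * (butterflyFactorial r * butterflyFactorial (n ∸ r)) ≡ butterflyFactorial n
butterflyFactorial-split {suc k} _ r<n with o , refl ← m≤n⇒∃[o]m+o≡n r<n = begin
  2 * (2 ^ k * butterflyFactorial (suc (k + o) ∸ k))  ≡⟨ cong (λ d → 2 * (2 ^ k * butterflyFactorial d)) gap ⟩
  2 * (2 ^ k * 2 ^ o)                                  ≡⟨ cong (2 *_) (sym (^-distribˡ-+-* 2 k o)) ⟩
  2 * 2 ^ (k + o)                                      ∎
  where
    open ≡-Reasoning
    gap : suc (k + o) ∸ k ≡ suc o
    gap = trans (cong (_∸ k) (sym (+-suc k o))) (m+n∸m≡n k (suc o))

module ButterflyPoset {P : FinitePoset} {n : ℕ} (IB : IsBinomialPoset P n butterflyFactorial) where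
  open FinitePoset P
  open IsBinomialPoset IB
  open IsDecPartialOrder isDecPartialOrder using () renaming (reflexive to ≤-reflexive; trans to ≤-trans)
  open BinomialPoset IB (λ k → m^n>0 2 (k ∸ 1)) public

  rankLevel-size≤2 : ∀ {k r} → 0 <ℕ r → r <ℕ n → (z : Fin k → Elem) → Injective _≡_ _≡_ z →
                     (∀ i → ρ (z i) ≡ r) → k ≤ℕ 2
  rankLevel-size≤2 {k} {r} 0<r r<n z z-injective ρz =
    *-cancelʳ-≤ k 2 chainsThroughOne {{nonZero}} (subst (k * chainsThroughOne ≤ℕ_) (sym (butterflyFactorial-split 0<r r<n)) bound)
    where
      chainsThroughOne : ℕ
      chainsThroughOne = butterflyFactorial r * butterflyFactorial (n ∸ r)
      nonZero : NonZero chainsThroughOne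
      nonZero = m*n≢0 _ _ {{m^n≢0 2 (r ∸ 1)}} {{m^n≢0 2 (n ∸ r ∸ 1)}}
      bound : k * chainsThroughOne ≤ℕ butterflyFactorial n
      bound = subst₂ (λ p q → k * (butterflyFactorial (r ∸ p) * butterflyFactorial (q ∸ r)) ≤ℕ butterflyFactorial (q ∸ p))
                ρ-⊥̂ ρ-⊤̂ (sameRank-maxChains-bound z z-injective ρz (⊥̂-least ⊤̂) (λ _ → ⊥̂-least _) (λ _ → ⊤̂-great _))

  one-of-two : ∀ {r a b c} → 0 <ℕ r → r <ℕ n → a ≢ b → ρ a ≡ r → ρ b ≡ r → ρ c ≡ r → c ≡ a ⊎ c ≡ b
  one-of-two {a = a} {b} {c} 0<r r<n a≢b ρa ρb ρc with c ≟ a | c ≟ b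
  ... | yes c≡a | _       = inj₁ c≡a
  ... | no _    | yes c≡b = inj₂ c≡b
  ... | no c≢a  | no c≢b  = contradiction (rankLevel-size≤2 0<r r<n abc abc-injective ρabc) λ { (s≤s (s≤s ())) }
    where
      abc : Fin 3 → Elem
      abc zero             = a
      abc (suc zero)       = b
      abc (suc (suc zero)) = c
      ρabc : ∀ i → ρ (abc i) ≡ _
      ρabc zero             = ρa
      ρabc (suc zero)       = ρb
      ρabc (suc (suc zero)) = ρc
      abc-injective : Injective _≡_ _≡_ abc
      abc-injective {zero}             {zero}             _ = refl
      abc-injective {zero}             {suc zero}         e = contradiction e a≢b
      abc-injective {zero}             {suc (suc zero)}   e = contradiction (sym e) c≢a
      abc-injective {suc zero}         {zero}             e = contradiction (sym e) a≢b
      abc-injective {suc zero}         {suc zero}         _ = refl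
      abc-injective {suc zero}         {suc (suc zero)}   e = contradiction (sym e) c≢b
      abc-injective {suc (suc zero)}   {zero}             e = contradiction e c≢a
      abc-injective {suc (suc zero)}   {suc zero}         e = contradiction e c≢b
      abc-injective {suc (suc zero)}   {suc (suc zero)}   _ = refl

  record TwoOfRank (r : ℕ) : Set where
    field
      fst snd : Elem
      fst≢snd : fst ≢ snd
      ρ-fst   : ρ fst ≡ r
      ρ-snd   : ρ snd ≡ r

  -- Kept abstract: otherwise projecting its fields makes Agda unfold the whole chain-picking construction,
  -- which exhausts memory.
  abstract
    two-of-rank : ∀ {r} → 0 <ℕ r → r <ℕ n → TwoOfRank r
    two-of-rank {suc k} _ r<n
      with w , _ , ρw ← ∃-below {⊤̂} (subst (suc (suc k) ≤ℕ_) (sym ρ-⊤̂) r<n)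
      with u , u≤w , ρu ← ∃-below {w} (subst (k ≤ℕ_) (sym ρw) (≤ℕ-trans (n≤1+n k) (n≤1+n (suc k))))
      with a , b , a≢b , _ , _ , ρa , ρb ← two-middles (s≤s (s≤s z≤n)) u≤w (trans ρw (cong (2 +_) (sym ρu)))
      = record { fst = a ; snd = b ; fst≢snd = a≢b ; ρ-fst = trans ρa (cong suc ρu) ; ρ-snd = trans ρb (cong suc ρu) }

  ρ≡suc⇒≤ : ∀ {x y} r → ρ x ≡ r → ρ y ≡ suc r → x ≤ y
  ρ≡suc⇒≤ {x} {y} zero ρx _ = subst (_≤ y) (≤∧ρ≡⇒≡ (⊥̂-least x) (trans ρ-⊥̂ (sym ρx))) (⊥̂-least y)
  ρ≡suc⇒≤ {x} {y} (suc k) ρx ρy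
    with u , u≤y , ρu ← ∃-below {y} (subst (k ≤ℕ_) (sym ρy) (≤ℕ-trans (n≤1+n k) (n≤1+n (suc k))))
    with a , b , a≢b , a≤y , b≤y , ρa , ρb ← two-middles (s≤s (s≤s z≤n)) u≤y (trans ρy (cong (2 +_) (sym ρu)))
    with one-of-two (s≤s z≤n) (subst (_≤ℕ n) ρy (ρ≤n y)) a≢b (trans ρa (cong suc ρu)) (trans ρb (cong suc ρu)) ρx
  ... | inj₁ x≡a = subst (_≤ y) (sym x≡a) a≤y
  ... | inj₂ x≡b = subst (_≤ y) (sym x≡b) b≤y

  ρ<⇒≤ : ∀ {x y} → ρ x <ℕ ρ y → x ≤ y
  ρ<⇒≤ {x} {y} ρx<ρy with d , ρy≡ ← m≤n⇒∃[o]m+o≡n ρx<ρy = by-gap d (trans (sym ρy≡) (+-comm (suc (ρ x)) d))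
    where
      by-gap : ∀ d {y} → ρ y ≡ d + suc (ρ x) → x ≤ y
      by-gap zero    ρy = ρ≡suc⇒≤ (ρ x) refl ρy
      by-gap (suc d) {y} ρy
        with v , v≤y , ρv ← ∃-below {y} (subst (d + suc (ρ x) ≤ℕ_) (sym ρy) (n≤1+n _))
        = ≤-trans (by-gap d ρv) v≤y

  ≤⇔≡⊎ρ< : ∀ x y → x ≤ y ⇔ (x ≡ y ⊎ ρ x <ℕ ρ y)
  ≤⇔≡⊎ρ< x y = mk⇔ to (λ { (inj₁ x≡y) → ≤-reflexive x≡y ; (inj₂ ρx<ρy) → ρ<⇒≤ ρx<ρy })
    where
      to : x ≤ y → x ≡ y ⊎ ρ x <ℕ ρ y
      to x≤y with x ≟ y
      ... | yes x≡y = inj₁ x≡y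
      ... | no  x≢y = inj₂ (ρ-strictMono x≤y x≢y)

module _ {P : FinitePoset} {n : ℕ} where
  open FinitePoset P

  ≅T-fromRankedBijection : (ρ : Elem → ℕ) → (∀ x y → x ≤ y ⇔ (x ≡ y ⊎ ρ x <ℕ ρ y)) →
    (f : Butterfly n → Elem) → (∀ t → ρ (f t) ≡ rankT t) → Injective _≡_ _≡_ f → (∀ x → ∃ λ t → f t ≡ x) →
    P ≅T n
  ≅T-fromRankedBijection ρ ≤⇔ f ρf f-injective f-surjective = record
    { iso      = mk↔ₛ′ g f (λ t → f-injective (f∘g (f t))) f∘g
    ; to-order = λ x y → to-≤T x y , from-≤T x y
    }
    where
      g : Elem → Butterfly n
      g x = proj₁ (f-surjective x)
      f∘g : ∀ x → f (g x) ≡ x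
      f∘g x = proj₂ (f-surjective x)
      rankT∘g : ∀ x → rankT (g x) ≡ ρ x
      rankT∘g x = trans (sym (ρf (g x))) (cong ρ (f∘g x))
      to-≤T : ∀ x y → x ≤ y → g x ≤T g y
      to-≤T x y x≤y with Equivalence.to (≤⇔ x y) x≤y
      ... | inj₁ x≡y   = inj₁ (cong g x≡y)
      ... | inj₂ ρx<ρy = inj₂ (subst₂ _<ℕ_ (sym (rankT∘g x)) (sym (rankT∘g y)) ρx<ρy)
      from-≤T : ∀ x y → g x ≤T g y → x ≤ y
      from-≤T x y (inj₁ gx≡gy) = Equivalence.from (≤⇔ x y) (inj₁ (trans (sym (f∘g x)) (trans (cong f gx≡gy) (f∘g y))))
      from-≤T x y (inj₂ lt)    = Equivalence.from (≤⇔ x y) (inj₂ (subst₂ _<ℕ_ (rankT∘g x) (rankT∘g y) lt))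

rankZero-≅T : ∀ {P} → IsBinomialPoset P 0 butterflyFactorial → P ≅T 0
rankZero-≅T {P} IB =
  ≅T-fromRankedBijection ρ ≤⇔≡⊎ρ< (λ { bot → ⊥̂ }) (λ { bot → ρ-⊥̂ }) (λ { {bot} {bot} _ → refl })
    (λ x → bot , ≤∧ρ≡⇒≡ (⊥̂-least x) (trans ρ-⊥̂ (sym (n≤0⇒n≡0 (ρ≤n x)))))
  where
    open IsBinomialPoset IB
    open ButterflyPoset IB

module PositiveRank {P : FinitePoset} {m : ℕ} (IB : IsBinomialPoset P (suc m) butterflyFactorial) where
  open FinitePoset P
  open IsBinomialPoset IB
  open ButterflyPoset IB

  level : (i : Fin m) → TwoOfRank (suc (toℕ i))
  level i = two-of-rank (s≤s z≤n) (s≤s (toℕ<n i))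

  levelElem : Fin m → Bool → Elem
  levelElem i true  = TwoOfRank.fst (level i)
  levelElem i false = TwoOfRank.snd (level i)

  levelElem-injective : ∀ i {b b′} → levelElem i b ≡ levelElem i b′ → b ≡ b′
  levelElem-injective i {true}  {true}  _ = refl
  levelElem-injective i {true}  {false} e = contradiction e (TwoOfRank.fst≢snd (level i))
  levelElem-injective i {false} {true}  e = contradiction (sym e) (TwoOfRank.fst≢snd (level i))
  levelElem-injective i {false} {false} _ = refl

  fromButterfly : Butterfly (suc m) → Elem
  fromButterfly bot       = ⊥̂
  fromButterfly (mid i b) = levelElem i b
  fromButterfly top       = ⊤̂

  ρ-fromButterfly : ∀ t → ρ (fromButterfly t) ≡ rankT t
  ρ-fromButterfly bot           = ρ-⊥̂
  ρ-fromButterfly (mid i true)  = TwoOfRank.ρ-fst (level i)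
  ρ-fromButterfly (mid i false) = TwoOfRank.ρ-snd (level i)
  ρ-fromButterfly top           = ρ-⊤̂

  fromButterfly-injective : Injective _≡_ _≡_ fromButterfly
  fromButterfly-injective {t} {t′} e =
    injective-on-ranks t t′ e (trans (sym (ρ-fromButterfly t)) (trans (cong ρ e) (ρ-fromButterfly t′)))
    where
      injective-on-ranks : ∀ t t′ → fromButterfly t ≡ fromButterfly t′ → rankT t ≡ rankT t′ → t ≡ t′
      injective-on-ranks bot       bot         _ _ = refl
      injective-on-ranks top       top         _ _ = refl
      injective-on-ranks (mid i b) (mid i′ b′) e r with toℕ-injective (suc-injective r)
      ... | refl = cong (mid i) (levelElem-injective i e)
      injective-on-ranks (mid i _) top         _ r = contradiction (suc-injective r) (<⇒≢ (toℕ<n i))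
      injective-on-ranks top       (mid i _)   _ r = contradiction (suc-injective (sym r)) (<⇒≢ (toℕ<n i))
      injective-on-ranks bot       (mid _ _)   _ ()
      injective-on-ranks bot       top         _ ()
      injective-on-ranks (mid _ _) bot         _ ()
      injective-on-ranks top       bot         _ ()

  fromButterfly-surjective : ∀ x → ∃ λ t → fromButterfly t ≡ x
  fromButterfly-surjective x = of-rank (ρ x) refl
    where
      of-rank : ∀ r → ρ x ≡ r → ∃ λ t → fromButterfly t ≡ x
      of-rank zero    ρx = bot , ≤∧ρ≡⇒≡ (⊥̂-least x) (trans ρ-⊥̂ (sym ρx))
      of-rank (suc k) ρx with k <ℕ? m
      ... | no k≮m = top , sym (≤∧ρ≡⇒≡ (⊤̂-great x) (trans ρx (trans (cong suc k≡m) (sym ρ-⊤̂))))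
        where
          k≡m : k ≡ m
          k≡m = ≤ℕ-antisym (≤-pred (subst (_≤ℕ suc m) ρx (ρ≤n x))) (≮⇒≥ k≮m)
      ... | yes k<m with one-of-two (s≤s z≤n) (s≤s (toℕ<n i)) fst≢snd ρ-fst ρ-snd
                           (trans ρx (cong suc (sym (toℕ-fromℕ< k<m))))
        where
          i : Fin m
          i = fromℕ< k<m
          open TwoOfRank (level i)
      ... | inj₁ x≡fst = mid (fromℕ< k<m) true  , sym x≡fst
      ... | inj₂ x≡snd = mid (fromℕ< k<m) false , sym x≡snd

  positiveRank-≅T : P ≅T suc m
  positiveRank-≅T =
    ≅T-fromRankedBijection ρ ≤⇔≡⊎ρ< fromButterfly ρ-fromButterfly fromButterfly-injective fromButterfly-surjective

lemma2p17 : (P : FinitePoset) (n : ℕ) →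
    IsBinomialPoset P n butterflyFactorial →
    P ≅T n
lemma2p17 P zero    IB = rankZero-≅T IB
lemma2p17 P (suc m) IB = PositiveRank.positiveRank-≅T IB
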